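{- For every integer $n\ge0$, the composite map $\sigma\circ\pi\colon\mathcal P_n\to\mathcal P_n$ sends each partition $\lambda$ of $n$ to its conjugate partition $\lambda^*$.
   Context: $\mathcal P$ is the set of integer partitions (including the empty one), $\mathcal P_n$ the partitions of $n$. A partition $\phi=(\phi_1,\dots,\phi_r)$ is sequentially congruent if $\phi_i\equiv\phi_{i+1}\pmod i$ for $1\le i\le r-1$ and $\phi_r\equiv0\pmod r$; $\mathcal S$ denotes the set of such partitions. The map $\pi\colon\mathcal P\to\mathcal S$ sends $\lambda=(\lambda_1,\dots,\lambda_r)$ to $\pi(\lambda)=(\lambda'_1,\dots,\lambda'_r)$ with $\lambda'_i=i\lambda_i+\sum_{j=i+1}^r\lambda_j$. The map $\sigma\colon\mathcal S\to\mathcal P$ sends $\phi=(\phi_1,\dots,\phi_r)\in\mathcal S$ (with $\phi_k=0$ for $k>r$) to the partition in which each $i\ge1$ occurs with multiplicity $(\phi_i-\phi_{i+1})/i$, i.e. $\sigma(\phi)=(1^{\phi_1-\phi_2}\,2^{(\phi_2-\phi_3)/2}\,3^{(\phi_3-\phi_4)/3}\cdots)$. The conjugate $\lambda^*$ of $\lambda$ is the partition whose Ferrers–Young diagram is the transpose of that of $\lambda$. -}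

module Defs where

open import Data.Nat using (ℕ; zero; suc; _+_; _*_; _∸_; _≤_; _<_; _≥_; _≤?_)
open import Data.Nat.DivMod using (_/_)
open import Data.Nat.ListAction using (sum)
open import Data.List using (List; []; _∷_; map; filter; length; upTo; replicate; _++_)
open import Data.List.Relation.Unary.All using (All)
open import Data.List.Relation.Unary.Linked using (Linked)
open import Data.Product using (_×_)
open import Relation.Binary.PropositionalEquality using (_≡_)

IsPartition : List ℕ → Set
IsPartition ls = Linked _≥_ ls × All (0 <_) ls

IsPartitionOf : ℕ → List ℕ → Set
IsPartitionOf n ls = IsPartition ls × sum ls ≡ n

piFrom : ℕ → List ℕ → List ℕ
piFrom i []       = []
piFrom i (x ∷ xs) = (i * x + sum xs) ∷ piFrom (suc i) xs

π : List ℕ → List ℕ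
π ls = piFrom 1 ls

head0 : List ℕ → ℕ
head0 []      = 0
head0 (x ∷ _) = x

-- σ: the part i occurs with multiplicity (φᵢ − φᵢ₊₁)/i.
-- sigmaFrom k processes the suffix starting at index i = suc k; larger parts
-- come first, so the output is weakly decreasing.
sigmaFrom : ℕ → List ℕ → List ℕ
sigmaFrom k []           = []
sigmaFrom k (φ ∷ rest)   =
  sigmaFrom (suc k) rest ++ replicate ((φ ∸ head0 rest) / suc k) (suc k)

σ : List ℕ → List ℕ
σ φ = sigmaFrom 0 φ

conj : List ℕ → List ℕ
conj []         = []
conj (x ∷ xs)   = map (λ j → length (filter (suc j ≤?_) (x ∷ xs))) (upTo x)

{-# OPTIONS --safe #-}
module Submission where

-- Both sides of the identity peel off the largest part in the same way.  Deleting
-- the first row λ₁ of the diagram shortens each of the first λ₂ columns by one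
-- and removes λ₁ − λ₂ columns of height 1, so λ* is (λ₂, λ₃, …)* with every part
-- raised by one, followed by λ₁ − λ₂ ones.  On the other side, consecutive entries
-- of π λ differ by i(λᵢ − λᵢ₊₁), so σ reads off exactly λᵢ − λᵢ₊₁ copies of the part
-- i.

open import Defs
open import Data.Nat using (ℕ; zero; suc; s≤s; _+_; _*_; _∸_; _≤_; _<_; _≥_; _≤?_; z≤n)
open import Data.Nat.Properties
  using (≤-refl; ≤-trans; ≤⇒≯; +-comm; +-suc; m≤m+n; m+n∸n≡m; m+[n∸m]≡n; m∸n+n≡m; *-comm)
open import Data.Nat.Tactic.RingSolver using (solve-∀)
open import Data.Nat.DivMod using (_/_; m*n/n≡m)
open import Data.Nat.ListAction using (sum)
open import Data.List using (List; []; _∷_; map; filter; length; applyUpTo; replicate; _++_)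
open import Data.List.Properties
  using (map-++; map-replicate; map-cong; map-id; map-∘; map-upTo; map-applyUpTo; filter-accept; filter-none)
open import Data.List.Relation.Unary.All as All using (All; []; _∷_)
open import Data.List.Relation.Unary.Linked as Linked using (Linked; []; [-]; _∷_)
open import Data.List.Relation.Unary.Linked.Properties using (Linked⇒All)
open import Data.Product using (_,_)
open import Function using (_∘_; const)
open import Level using (Level)
open import Relation.Binary.PropositionalEquality using (_≡_; refl; sym; trans; cong; cong₂; module ≡-Reasoning)

private
  variable
    a : Level
    A : Set a

applyUpTo-++ : ∀ (f : ℕ → A) m n → applyUpTo f (m + n) ≡ applyUpTo f m ++ applyUpTo (f ∘ (m +_)) n
applyUpTo-++ f zero    n = refl
applyUpTo-++ f (suc m) n = cong (f 0 ∷_) (applyUpTo-++ (f ∘ suc) m n)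

applyUpTo-cong : ∀ {f g : ℕ → A} n → (∀ {i} → i < n → f i ≡ g i) → applyUpTo f n ≡ applyUpTo g n
applyUpTo-cong zero    f≗g = refl
applyUpTo-cong (suc n) f≗g = cong₂ _∷_ (f≗g (s≤s z≤n)) (applyUpTo-cong n (f≗g ∘ s≤s))

applyUpTo-const : ∀ n (x : A) → applyUpTo (const x) n ≡ replicate n x
applyUpTo-const zero    x = refl
applyUpTo-const (suc n) x = cong (x ∷_) (applyUpTo-const n x)

partsAbove : List ℕ → ℕ → ℕ
partsAbove ls j = length (filter (suc j ≤?_) ls)

partsAbove-∷-< : ∀ {x j} xs → j < x → partsAbove (x ∷ xs) j ≡ suc (partsAbove xs j)
partsAbove-∷-< xs j<x = cong length (filter-accept (suc _ ≤?_) j<x)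

partsAbove-≤ : ∀ {j xs} → All (_≤ j) xs → partsAbove xs j ≡ 0
partsAbove-≤ xs≤j = cong length (filter-none (suc _ ≤?_) (All.map ≤⇒≯ xs≤j))

conj-applyUpTo : ∀ xs → conj xs ≡ applyUpTo (partsAbove xs) (head0 xs)
conj-applyUpTo []       = refl
conj-applyUpTo (x ∷ xs) = map-upTo (partsAbove (x ∷ xs)) x

head0-≤ : ∀ {x xs} → Linked _≥_ (x ∷ xs) → head0 xs ≤ x
head0-≤ [-]       = z≤n
head0-≤ (x≥y ∷ _) = x≥y

All-≤-head0 : ∀ {xs} → Linked _≥_ xs → All (_≤ head0 xs) xs
All-≤-head0 []          = []
All-≤-head0 [-]         = ≤-refl ∷ []
All-≤-head0 l@(_ ∷ _)   = Linked⇒All (λ p q → ≤-trans q p) ≤-refl l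

conj-∷ : ∀ {x xs} → Linked _≥_ (x ∷ xs) →
         conj (x ∷ xs) ≡ map suc (conj xs) ++ replicate (x ∸ head0 xs) 1
conj-∷ {x} {xs} l = begin
  conj (x ∷ xs)                                                   ≡⟨ conj-applyUpTo (x ∷ xs) ⟩
  applyUpTo (partsAbove (x ∷ xs)) x                               ≡⟨ applyUpTo-cong x (partsAbove-∷-< xs) ⟩
  applyUpTo (suc ∘ partsAbove xs) x                               ≡⟨ cong (applyUpTo _) (m+[n∸m]≡n (head0-≤ l)) ⟨
  applyUpTo (suc ∘ partsAbove xs) (h + (x ∸ h))                   ≡⟨ applyUpTo-++ _ h (x ∸ h) ⟩
  applyUpTo (suc ∘ partsAbove xs) h ++ applyUpTo (suc ∘ partsAbove xs ∘ (h +_)) (x ∸ h)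
                                                                  ≡⟨ cong₂ _++_ oldColumns newColumns ⟩
  map suc (conj xs) ++ replicate (x ∸ h) 1                        ∎
  where
  open ≡-Reasoning
  h = head0 xs

  oldColumns : applyUpTo (suc ∘ partsAbove xs) h ≡ map suc (conj xs)
  oldColumns = trans (sym (map-applyUpTo (partsAbove xs) suc h)) (cong (map suc) (sym (conj-applyUpTo xs)))

  newColumns : applyUpTo (suc ∘ partsAbove xs ∘ (h +_)) (x ∸ h) ≡ replicate (x ∸ h) 1
  newColumns = trans (applyUpTo-cong (x ∸ h) λ {i} _ →
                        cong suc (partsAbove-≤ (All.map (λ p → ≤-trans p (m≤m+n h i)) (All-≤-head0 (Linked.tail l)))))
                     (applyUpTo-const (x ∸ h) 1)

piFrom-gap : ∀ i x xs → head0 xs ≤ x →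
        i * x + sum xs ≡ i * (x ∸ head0 xs) + head0 (piFrom (suc i) xs)
piFrom-gap i x []       _   = refl
piFrom-gap i x (y ∷ ys) y≤x = begin
  i * x + (y + sum ys)                  ≡⟨ cong (λ z → i * z + (y + sum ys)) (m∸n+n≡m y≤x) ⟨
  i * (x ∸ y + y) + (y + sum ys)        ≡⟨ regroup i (x ∸ y) y (sum ys) ⟩
  i * (x ∸ y) + (suc i * y + sum ys)    ∎
  where
  open ≡-Reasoning
  regroup : ∀ m d y s → m * (d + y) + (y + s) ≡ m * d + (suc m * y + s)
  regroup = solve-∀

piFrom-gap-/ : ∀ k x xs → head0 xs ≤ x →
                 (suc k * x + sum xs ∸ head0 (piFrom (suc (suc k)) xs)) / suc k ≡ x ∸ head0 xs
piFrom-gap-/ k x xs h≤x = begin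
  (suc k * x + sum xs ∸ p) / suc k                    ≡⟨ cong (λ z → (z ∸ p) / suc k) (piFrom-gap (suc k) x xs h≤x) ⟩
  (suc k * (x ∸ head0 xs) + p ∸ p) / suc k            ≡⟨ cong (_/ suc k) (m+n∸n≡m _ p) ⟩
  suc k * (x ∸ head0 xs) / suc k                      ≡⟨ cong (_/ suc k) (*-comm (suc k) (x ∸ head0 xs)) ⟩
  (x ∸ head0 xs) * suc k / suc k                      ≡⟨ m*n/n≡m (x ∸ head0 xs) (suc k) ⟩
  x ∸ head0 xs                                        ∎
  where
  open ≡-Reasoning
  p = head0 (piFrom (suc (suc k)) xs)

-- sigmaFrom k emits the part i + k where σ would emit i, hence the shift by k.
sigmaFrom-piFrom : ∀ k {ls} → Linked _≥_ ls → sigmaFrom k (piFrom (suc k) ls) ≡ map (k +_) (conj ls)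
sigmaFrom-piFrom k {[]}     _ = refl
sigmaFrom-piFrom k {x ∷ xs} l = begin
  sigmaFrom k (piFrom (suc k) (x ∷ xs))
      ≡⟨ cong₂ _++_ (sigmaFrom-piFrom (suc k) (Linked.tail l))
                    (cong (λ m → replicate m (suc k)) (piFrom-gap-/ k x xs (head0-≤ l))) ⟩
  map (suc k +_) (conj xs) ++ replicate (x ∸ head0 xs) (suc k)
      ≡⟨ cong₂ _++_ (trans (map-cong (sym ∘ +-suc k) (conj xs)) (map-∘ (conj xs)))
                    (sym (trans (map-replicate (k +_) (x ∸ head0 xs) 1) (cong (replicate _) (+-comm k 1)))) ⟩
  map (k +_) (map suc (conj xs)) ++ map (k +_) (replicate (x ∸ head0 xs) 1)
      ≡⟨ map-++ (k +_) (map suc (conj xs)) _ ⟨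
  map (k +_) (map suc (conj xs) ++ replicate (x ∸ head0 xs) 1)
      ≡⟨ cong (map (k +_)) (conj-∷ l) ⟨
  map (k +_) (conj (x ∷ xs))
      ∎
  where open ≡-Reasoning

theorem3p1 : (n : ℕ) (ls : List ℕ) → IsPartitionOf n ls → σ (π ls) ≡ conj ls
theorem3p1 n ls ((decreasing , _) , _) = trans (sigmaFrom-piFrom 0 decreasing) (map-id (conj ls))
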